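{- For every integer $n\ge 6$, $\mathrm{co}^{+}\mathrm{ex}(n,C_5^{ - })=\lfloor n/3\rfloor$.
   Context: A $3$-graph $H$ is a hypergraph all of whose edges have size $3$. For a $2$-set $S$ of vertices, its co-degree is the number of edges of $H$ containing $S$. The minimum positive co-degree $\delta_2^{+}(H)$ of a non-empty $3$-graph $H$ is the minimum co-degree over all $2$-sets $S$ whose co-degree is nonzero. For a $3$-graph $F$, the positive co-degree Turán number $\mathrm{co}^{+}\mathrm{ex}(n,F)$ is the maximum of $\delta_2^{+}(H)$ over all $n$-vertex non-empty $3$-graphs $H$ containing no copy of $F$. $C_5^{ - }$ denotes the $3$-graph on vertices $a,b,c,d,e$ with edges $\{abc, bcd, cde, dea\}$. -}

module Defs where

open import Data.Nat using (ℕ; zero; suc; _+_; _<_; _≤_)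
open import Data.Fin using (Fin)
open import Data.Bool using (Bool; true; false; if_then_else_)
open import Data.List using (List; map)
open import Data.Nat.ListAction using (sum)
open import Data.Empty using (⊥)
open import Data.List.Base using (allFin)
open import Data.Product using (Σ; ∃; ∃-syntax; _×_; _,_)
open import Relation.Binary.PropositionalEquality using (_≡_; _≢_)

-- A 3-graph on vertex set Fin n: edge x y z = true iff {x,y,z} is an edge.
-- The indicator is symmetric under permutations and only true on
-- triples of pairwise distinct vertices.
record ThreeGraph (n : ℕ) : Set where
  field
    edge    : Fin n → Fin n → Fin n → Bool
    sym₁₂   : ∀ x y z → edge x y z ≡ edge y x z
    sym₂₃   : ∀ x y z → edge x y z ≡ edge x z y
    distinct : ∀ x y z → edge x y z ≡ true → (x ≢ y) × (y ≢ z) × (x ≢ z)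
open ThreeGraph public

codeg : ∀ {n} → ThreeGraph n → Fin n → Fin n → ℕ
codeg {n} H x y = sum (map (λ z → if edge H x y z then 1 else 0) (allFin n))

NonEmpty : ∀ {n} → ThreeGraph n → Set
NonEmpty H = ∃[ x ] ∃[ y ] ∃[ z ] edge H x y z ≡ true

IsMinPosCodeg : ∀ {n} → ThreeGraph n → ℕ → Set
IsMinPosCodeg {n} H m =
  (∃[ x ] ∃[ y ] (x ≢ y) × (0 < codeg H x y) × (codeg H x y ≡ m))
  × (∀ x y → x ≢ y → 0 < codeg H x y → m ≤ codeg H x y)

ContainsC5minus : ∀ {n} → ThreeGraph n → Set
ContainsC5minus {n} H =
  ∃[ a ] ∃[ b ] ∃[ c ] ∃[ d ] ∃[ e ]
    ((a ≢ b) × (a ≢ c) × (a ≢ d) × (a ≢ e) × (b ≢ c) × (b ≢ d) × (b ≢ e)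
       × (c ≢ d) × (c ≢ e) × (d ≢ e))
    × (edge H a b c ≡ true) × (edge H b c d ≡ true)
    × (edge H c d e ≡ true) × (edge H d e a ≡ true)

Achievable : ℕ → ℕ → Set
Achievable n m = Σ (ThreeGraph n) λ H →
  NonEmpty H × (ContainsC5minus H → ⊥) × IsMinPosCodeg H m

CoPlusExC5minus≡ : ℕ → ℕ → Set
CoPlusExC5minus≡ n k = Achievable n k × (∀ m → Achievable n m → m ≤ k)

-- Lower bound: colour the vertices by their residue mod 3 and take all rainbow triples.
-- Two edges abc, bcd force d into the colour class of a, so dea is never an edge; and a
-- pair of positive co-degree has a whole colour class, of size at least ⌊n/3⌋, as link.
--
-- Upper bound: let m be the minimum positive co-degree and double count, over the vertices t,
-- how many pairs from a chosen list have t in their link.  Take an edge xyz.  If no vertex lies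
-- in the links of two of its pairs, the three co-degrees sum to at most n.  Otherwise there are
-- edges cpq, cpr, cqr.  A vertex t outside {c,p,q,r} lying in two of the links of pq, pr, qr
-- (or, when pqr is an edge as well, of any two of the six pairs inside {c,p,q,r}) closes a tight
-- walk abc, bcd, cde, dea, i.e. a copy of C₅⁻.  Accounting for c, p, q, r separately this gives
-- 3m ≤ n - 1 if pqr is not an edge and 6m ≤ n + 8 if it is; for n ≥ 6 both imply m ≤ ⌊n/3⌋.

module Submission where

open import Defs
open import Data.Nat using (ℕ; zero; suc; _+_; _*_; _≤_; _<_; z≤n; s≤s; _/_)
open import Data.Nat.Properties hiding (_≟_)
open import Data.Nat.DivMod using (m*n/n≡m; /-monoˡ-≤; m/n≡1+[m∸n]/n)
import Data.Nat.ListAction as List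
open import Data.Fin using (Fin; zero; suc; toℕ; _≟_)
open import Data.Fin.Properties using (all?; any?; ¬∀⟶∃¬)
open import Data.Bool using (Bool; true; false; if_then_else_; _∧_; not)
import Data.Bool.Properties as Bool
open import Data.Empty using (⊥; ⊥-elim)
open import Data.Unit using (tt)
open import Data.Product using (∃-syntax; _×_; _,_; proj₁; proj₂)
open import Data.Sum using (_⊎_; inj₁; inj₂)
open import Data.List using (List; []; _∷_; map; length; tabulate)
open import Data.List.Base using (allFin)
open import Data.List.Properties using (map-tabulate)
open import Data.List.Membership.Propositional using (_∈_; _∉_)
open import Data.List.Relation.Unary.All using (All; []; _∷_)
import Data.List.Relation.Unary.All as All
open import Data.List.Relation.Unary.Any using (here; there)
open import Data.List.Relation.Unary.AllPairs using (AllPairs; []; _∷_)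
open import Data.List.Relation.Unary.Unique.Propositional using (Unique)
open import Data.List.Relation.Binary.Pointwise using (Pointwise; []; _∷_)
open import Function using (_∘_)
open import Relation.Nullary using (¬_; ¬?; does; yes; no)
open import Relation.Nullary.Decidable using (toWitness; _→-dec_; _×-dec_; _⊎-dec_)
open import Relation.Binary.PropositionalEquality
open import Algebra.Properties.CommutativeMonoid.Sum +-0-commutativeMonoid
  using (sum-syntax; ∑-distrib-+; sum-cong-≗) renaming (sum to ∑)

private variable
  n : ℕ

sum-map-allFin : (f : Fin n → ℕ) → List.sum (map f (allFin n)) ≡ ∑ f
sum-map-allFin f = trans (cong List.sum (map-tabulate (λ x → x) f)) (sum-tabulate f)
  where
  sum-tabulate : ∀ {n} (f : Fin n → ℕ) → List.sum (tabulate f) ≡ ∑ f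
  sum-tabulate {zero}  f = refl
  sum-tabulate {suc n} f = cong (f zero +_) (sum-tabulate (f ∘ suc))

∑-mono-≤ : {f g : Fin n → ℕ} → (∀ t → f t ≤ g t) → ∑ f ≤ ∑ g
∑-mono-≤ {zero}  f≤g = z≤n
∑-mono-≤ {suc n} f≤g = +-mono-≤ (f≤g zero) (∑-mono-≤ (f≤g ∘ suc))

∑-const-1 : ∑[ t < n ] 1 ≡ n
∑-const-1 {zero}  = refl
∑-const-1 {suc n} = cong suc ∑-const-1

∑-const-0 : ∑[ t < n ] 0 ≡ 0
∑-const-0 {zero}  = refl
∑-const-0 {suc n} = ∑-const-0 {n}

pointMass : Fin n → ℕ → Fin n → ℕ
pointMass v c t = if does (t ≟ v) then c else 0

∑-pointMass : (v : Fin n) (c : ℕ) → ∑ (pointMass v c) ≡ c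
∑-pointMass {suc n} zero    c = trans (cong (c +_) (∑-const-0 {n})) (+-identityʳ c)
∑-pointMass {suc n} (suc v) c = ∑-pointMass v c

sum-map-pointMass-∉ : (g : Fin n → ℕ) {v : Fin n} (c : ℕ) {K : List (Fin n)} →
  All (v ≢_) K → List.sum (map (λ t → g t + pointMass v c t) K) ≡ List.sum (map g K)
sum-map-pointMass-∉ g c [] = refl
sum-map-pointMass-∉ g {v} c {t ∷ K} (v≢t ∷ v∉K) with t ≟ v
... | yes t≡v = ⊥-elim (v≢t (sym t≡v))
... | no _    = cong₂ _+_ (+-identityʳ (g t)) (sum-map-pointMass-∉ g c v∉K)

-- Induction on K: adding the point masses g v and f v at v to f and g makes them agree at v.
∑-≤-except : {f g : Fin n → ℕ} (K : List (Fin n)) → Unique K → (∀ t → t ∉ K → f t ≤ g t) →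
  ∑ f + List.sum (map g K) ≤ ∑ g + List.sum (map f K)
∑-≤-except []      _ f≤g = +-monoˡ-≤ 0 (∑-mono-≤ (λ t → f≤g t (λ ())))
∑-≤-except {f = f} {g} (v ∷ K) (v∉K ∷ K-unique) f≤g = begin
  ∑ f + (g v + List.sum (map g K))         ≡⟨ +-assoc (∑ f) (g v) _ ⟨
  ∑ f + g v + List.sum (map g K)           ≡⟨ cong₂ _+_ (∑-plus-pointMass f (g v)) (sum-map-pointMass-∉ g (f v) v∉K) ⟨
  ∑ f′ + List.sum (map g′ K)               ≤⟨ ∑-≤-except K K-unique f′≤g′ ⟩
  ∑ g′ + List.sum (map f′ K)               ≡⟨ cong₂ _+_ (∑-plus-pointMass g (f v)) (sum-map-pointMass-∉ f (g v) v∉K) ⟩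
  ∑ g + f v + List.sum (map f K)           ≡⟨ +-assoc (∑ g) (f v) _ ⟩
  ∑ g + (f v + List.sum (map f K))         ∎
  where
  open ≤-Reasoning
  f′ g′ : Fin _ → ℕ
  f′ t = f t + pointMass v (g v) t
  g′ t = g t + pointMass v (f v) t

  ∑-plus-pointMass : ∀ h c → ∑ (λ t → h t + pointMass v c t) ≡ ∑ h + c
  ∑-plus-pointMass h c = trans (∑-distrib-+ h (pointMass v c)) (cong (∑ h +_) (∑-pointMass v c))

  f′≤g′ : ∀ t → t ∉ K → f′ t ≤ g′ t
  f′≤g′ t t∉K with t ≟ v
  ... | yes refl = ≤-reflexive (+-comm (f t) (g t))
  ... | no t≢v   = +-monoˡ-≤ 0 (f≤g t λ { (here t≡v) → t≢v t≡v ; (there t∈K) → t∉K t∈K })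

∑-≤-length-except : {f : Fin n → ℕ} (K : List (Fin n)) → Unique K → (∀ t → t ∉ K → f t ≤ 1) →
  ∑ f + length K ≤ n + List.sum (map f K)
∑-≤-length-except {n} {f} K K-unique f≤1 =
  subst₂ (λ a b → ∑ f + a ≤ b + List.sum (map f K)) (sum-map-1 K) ∑-const-1
    (∑-≤-except K K-unique f≤1)
  where
  sum-map-1 : ∀ (K : List (Fin n)) → List.sum (map (λ _ → 1) K) ≡ length K
  sum-map-1 []      = refl
  sum-map-1 (_ ∷ K) = cong suc (sum-map-1 K)

sum-map-≥ : ∀ {a} {A : Set a} {m} (f : A → ℕ) {xs : List A} → All (λ x → m ≤ f x) xs →
  length xs * m ≤ List.sum (map f xs)
sum-map-≥ f []            = z≤n
sum-map-≥ f (m≤fx ∷ m≤fs) = +-mono-≤ m≤fx (sum-map-≥ f m≤fs)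

≤-∑ : (f : Fin n → ℕ) (v : Fin n) → f v ≤ ∑ f
≤-∑ f zero    = m≤m+n (f zero) _
≤-∑ f (suc v) = ≤-trans (≤-∑ (f ∘ suc) v) (m≤n+m _ (f zero))

3*m≤n⇒m≤n/3 : ∀ {m n} → 3 * m ≤ n → m ≤ n / 3
3*m≤n⇒m≤n/3 {m} {n} 3m≤n = subst (_≤ n / 3) (m*n/n≡m m 3) (/-monoˡ-≤ 3 (subst (_≤ n) (*-comm 3 m) 3m≤n))

3*m+4≤n+3⇒m≤n/3 : ∀ {m n} → 3 * m + 4 ≤ n + 3 → m ≤ n / 3
3*m+4≤n+3⇒m≤n/3 {m} {n} h =
  3*m≤n⇒m≤n/3 (≤-pred (m≤n⇒m≤1+n (+-cancelʳ-≤ 3 (suc (3 * m)) n (≤-trans (≤-reflexive (sym (+-suc (3 * m) 3))) h))))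

6*m+4≤n+12⇒m≤n/3 : ∀ {m n} → 6 ≤ n → 6 * m + 4 ≤ n + 12 → m ≤ n / 3
6*m+4≤n+12⇒m≤n/3 {m} {n} 6≤n h with m ≤? 2
... | yes m≤2 = ≤-trans m≤2 (/-monoˡ-≤ 3 6≤n)
... | no  m≰2 = 3*m≤n⇒m≤n/3 (+-cancelʳ-≤ 13 (3 * m) n (begin
  3 * m + (9 + 4)        ≤⟨ +-monoʳ-≤ (3 * m) (+-monoˡ-≤ 4 (*-monoʳ-≤ 3 (≰⇒> m≰2))) ⟩
  3 * m + (3 * m + 4)    ≡⟨ +-assoc (3 * m) (3 * m) 4 ⟨
  3 * m + 3 * m + 4      ≡⟨ cong (_+ 4) (*-distribʳ-+ m 3 3) ⟨
  6 * m + 4              ≤⟨ h ⟩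
  n + 12                 ≤⟨ +-monoʳ-≤ n (n≤1+n 12) ⟩
  n + 13                 ∎))
  where open ≤-Reasoning

𝟙 : Bool → ℕ
𝟙 b = if b then 1 else 0

𝟙≤1 : ∀ b → 𝟙 b ≤ 1
𝟙≤1 true  = s≤s z≤n
𝟙≤1 false = z≤n

two-of-three : ∀ u v w → ¬ 𝟙 u + (𝟙 v + (𝟙 w + 0)) ≤ 1 →
  (u ≡ true × v ≡ true) ⊎ (u ≡ true × w ≡ true) ⊎ (v ≡ true × w ≡ true)
two-of-three true  true  _     _  = inj₁ (refl , refl)
two-of-three true  false true  _  = inj₂ (inj₁ (refl , refl))
two-of-three false true  true  _  = inj₂ (inj₂ (refl , refl))
two-of-three true  false false ≰1 = ⊥-elim (≰1 (s≤s z≤n))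
two-of-three false true  false ≰1 = ⊥-elim (≰1 (s≤s z≤n))
two-of-three false false true  ≰1 = ⊥-elim (≰1 (s≤s z≤n))
two-of-three false false false ≰1 = ⊥-elim (≰1 z≤n)

module _ {n : ℕ} (H : ThreeGraph n) where

  Edge : Fin n → Fin n → Fin n → Set
  Edge x y z = edge H x y z ≡ true

  private variable
    c p q r t x y z : Fin n

  edge-swap₁₂ : Edge x y z → Edge y x z
  edge-swap₁₂ {x} {y} {z} xyz = trans (sym (sym₁₂ H x y z)) xyz

  edge-swap₂₃ : Edge x y z → Edge x z y
  edge-swap₂₃ {x} {y} {z} xyz = trans (sym (sym₂₃ H x y z)) xyz

  edge-rotate≡ : ∀ x y z → edge H x y z ≡ edge H y z x
  edge-rotate≡ x y z = trans (sym₁₂ H x y z) (sym₂₃ H y x z)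

  edge-rotate : Edge x y z → Edge y z x
  edge-rotate {x} {y} {z} xyz = trans (sym (edge-rotate≡ x y z)) xyz

  edge⇒x≢y : Edge x y z → x ≢ y
  edge⇒x≢y {x} {y} {z} xyz = proj₁ (distinct H x y z xyz)

  edge⇒y≢z : Edge x y z → y ≢ z
  edge⇒y≢z {x} {y} {z} xyz = proj₁ (proj₂ (distinct H x y z xyz))

  edge⇒x≢z : Edge x y z → x ≢ z
  edge⇒x≢z {x} {y} {z} xyz = proj₂ (proj₂ (distinct H x y z xyz))

  link : Fin n → Fin n → Fin n → ℕ
  link x y t = 𝟙 (edge H x y t)

  codeg≡∑link : ∀ x y → codeg H x y ≡ ∑ (link x y)
  codeg≡∑link x y = sum-map-allFin (link x y)

  link-excludes₁ : ∀ x y → link x y x ≤ 0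
  link-excludes₁ x y with edge H x y x in xyx
  ... | true  = ⊥-elim (edge⇒x≢z xyx refl)
  ... | false = z≤n

  link-excludes₂ : ∀ x y → link x y y ≤ 0
  link-excludes₂ x y with edge H x y y in xyy
  ... | true  = ⊥-elim (edge⇒y≢z xyy refl)
  ... | false = z≤n

  non-edge-link : edge H x y z ≡ false → link x y z ≤ 0
  non-edge-link xyz = ≤-reflexive (cong 𝟙 xyz)

  edge⇒0<codeg : Edge x y z → 0 < codeg H x y
  edge⇒0<codeg {x} {y} {z} xyz = subst (0 <_) (sym (codeg≡∑link x y))
    (≤-trans (≤-reflexive (cong 𝟙 (sym xyz))) (≤-∑ (link x y) z))

  pairsOf : Fin n → Fin n → Fin n → List (Fin n × Fin n)
  pairsOf x y z = (x , y) ∷ (x , z) ∷ (y , z) ∷ []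

  linkCount : List (Fin n × Fin n) → Fin n → ℕ
  linkCount ps t = List.sum (map (λ (x , y) → link x y t) ps)

  ∑-linkCount : ∀ ps → ∑ (linkCount ps) ≡ List.sum (map (λ (x , y) → codeg H x y) ps)
  ∑-linkCount []             = ∑-const-0 {n}
  ∑-linkCount ((x , y) ∷ ps) = begin
    ∑ (λ t → link x y t + linkCount ps t)  ≡⟨ ∑-distrib-+ (link x y) (linkCount ps) ⟩
    ∑ (link x y) + ∑ (linkCount ps)        ≡⟨ cong₂ _+_ (sym (codeg≡∑link x y)) (∑-linkCount ps) ⟩
    codeg H x y + _                        ∎
    where open ≡-Reasoning

  linkCount-≤ : ∀ {ps bs t} → Pointwise (λ (x , y) b → link x y t ≤ b) ps bs →
    linkCount ps t ≤ List.sum bs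
  linkCount-≤ []           = z≤n
  linkCount-≤ (le ∷ les)   = +-mono-≤ le (linkCount-≤ les)

  Exclusive : Fin n → Fin n × Fin n → Fin n × Fin n → Set
  Exclusive t (x , y) (x′ , y′) = Edge x y t → Edge x′ y′ t → ⊥

  linkCount≤1 : ∀ {ps t} → AllPairs (Exclusive t) ps → linkCount ps t ≤ 1
  linkCount≤1 [] = z≤n
  linkCount≤1 {(x , y) ∷ ps} {t} (excl ∷ excls) with edge H x y t in xyt
  ... | true  = s≤s (≤-reflexive (linkCount≡0 (All.map (λ ex → ex xyt) excl)))
    where
    linkCount≡0 : ∀ {ps} → All (λ (x′ , y′) → ¬ Edge x′ y′ t) ps → linkCount ps t ≡ 0
    linkCount≡0 [] = refl
    linkCount≡0 {(x′ , y′) ∷ ps} (¬x′y′t ∷ rest) with edge H x′ y′ t in x′y′t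
    ... | true  = ⊥-elim (¬x′y′t refl)
    ... | false = linkCount≡0 rest
  ... | false = linkCount≤1 excls

  walk⇒C5⁻ : ∀ {a b c d e} → b ≢ e → Edge a b c → Edge b c d → Edge c d e → Edge d e a →
    ContainsC5minus H
  walk⇒C5⁻ {a} {b} {c} {d} {e} b≢e abc bcd cde dea =
    a , b , c , d , e ,
    (edge⇒x≢y abc , edge⇒x≢z abc , ≢-sym (edge⇒x≢z dea) , ≢-sym (edge⇒y≢z dea) ,
     edge⇒y≢z abc , edge⇒x≢z bcd , b≢e , edge⇒y≢z bcd , edge⇒x≢z cde , edge⇒y≢z cde) ,
    abc , bcd , cde , dea

  star-vertices-unique : Edge c p q → Edge c p r → Edge c q r → Unique (c ∷ p ∷ q ∷ r ∷ [])
  star-vertices-unique cpq cpr cqr =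
    (edge⇒x≢y cpq ∷ edge⇒x≢z cpq ∷ edge⇒x≢z cpr ∷ []) ∷
    (edge⇒y≢z cpq ∷ edge⇒y≢z cpr ∷ []) ∷ (edge⇒y≢z cqr ∷ []) ∷ [] ∷ []

  K4⁻-vertex-links : ∀ {c p q r} → edge H p q r ≡ false → List.sum (map (linkCount (pairsOf p q r)) (c ∷ p ∷ q ∷ r ∷ [])) ≤ 3
  K4⁻-vertex-links {c} {p} {q} {r} pqr =
    +-mono-≤ at-c (+-mono-≤ at-p (+-mono-≤ at-q (+-mono-≤ at-r z≤n)))
    where
    at-c = linkCount-≤ (𝟙≤1 _ ∷ 𝟙≤1 _ ∷ 𝟙≤1 _ ∷ [])
    at-p = linkCount-≤ (link-excludes₁ p q ∷ link-excludes₁ p r ∷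
                        non-edge-link (trans (sym (edge-rotate≡ p q r)) pqr) ∷ [])
    at-q = linkCount-≤ (link-excludes₂ p q ∷ non-edge-link (trans (sym₂₃ H p r q) pqr) ∷
                        link-excludes₁ q r ∷ [])
    at-r = linkCount-≤ (non-edge-link pqr ∷ link-excludes₂ p r ∷ link-excludes₂ q r ∷ [])

  K4-pairs : Fin n → Fin n → Fin n → Fin n → List (Fin n × Fin n)
  K4-pairs c p q r = (c , p) ∷ (c , q) ∷ (c , r) ∷ pairsOf p q r

  K4-vertex-links : List.sum (map (linkCount (K4-pairs c p q r)) (c ∷ p ∷ q ∷ r ∷ [])) ≤ 12
  K4-vertex-links {c} {p} {q} {r} =
    +-mono-≤ at-c (+-mono-≤ at-p (+-mono-≤ at-q (+-mono-≤ at-r z≤n)))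
    where
    at-c = linkCount-≤ (link-excludes₁ c p ∷ link-excludes₁ c q ∷ link-excludes₁ c r ∷
                        𝟙≤1 _ ∷ 𝟙≤1 _ ∷ 𝟙≤1 _ ∷ [])
    at-p = linkCount-≤ (link-excludes₂ c p ∷ 𝟙≤1 _ ∷ 𝟙≤1 _ ∷
                        link-excludes₁ p q ∷ link-excludes₁ p r ∷ 𝟙≤1 _ ∷ [])
    at-q = linkCount-≤ (𝟙≤1 _ ∷ link-excludes₂ c q ∷ 𝟙≤1 _ ∷
                        link-excludes₂ p q ∷ 𝟙≤1 _ ∷ link-excludes₁ q r ∷ [])
    at-r = linkCount-≤ (𝟙≤1 _ ∷ 𝟙≤1 _ ∷ link-excludes₂ c r ∷
                        𝟙≤1 _ ∷ link-excludes₂ p r ∷ link-excludes₂ q r ∷ [])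

  module _ (free : ¬ ContainsC5minus H) where

    star-exclusive : t ≢ x → Edge x p q → Edge x p r → Edge x q r → AllPairs (Exclusive t) (pairsOf p q r)
    star-exclusive {t} {x} {p} {q} {r} t≢x xpq xpr xqr =
      (pq-pr ∷ pq-qr ∷ []) ∷ (pr-qr ∷ []) ∷ [] ∷ []
      where
      x≢t = ≢-sym t≢x
      pq-pr : Exclusive t (p , q) (p , r)
      pq-pr pqt prt = free (walk⇒C5⁻ x≢t (edge-swap₁₂ (edge-swap₂₃ xqr)) (edge-swap₂₃ xpq)
                                         (edge-swap₁₂ pqt) (edge-swap₂₃ prt))
      pq-qr : Exclusive t (p , q) (q , r)
      pq-qr pqt qrt = free (walk⇒C5⁻ x≢t (edge-swap₁₂ (edge-swap₂₃ xpr)) xpq pqt (edge-swap₂₃ qrt))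
      pr-qr : Exclusive t (p , r) (q , r)
      pr-qr prt qrt = free (walk⇒C5⁻ x≢t (edge-swap₁₂ (edge-swap₂₃ xpq)) xpr prt
                                         (edge-swap₂₃ (edge-swap₁₂ qrt)))

    opposite-exclusive : p ≢ r → Edge c p q → Edge c q r → Exclusive t (c , p) (q , r)
    opposite-exclusive p≢r cpq cqr cpt qrt =
      free (walk⇒C5⁻ p≢r (edge-swap₁₂ (edge-swap₂₃ (edge-swap₁₂ cpt))) (edge-swap₁₂ cpq) cqr qrt)

    K4-exclusive : Edge c p q → Edge c p r → Edge c q r → Edge p q r → t ∉ (c ∷ p ∷ q ∷ r ∷ []) →
      AllPairs (Exclusive t) (K4-pairs c p q r)
    K4-exclusive {c} {p} {q} {r} {t} cpq cpr cqr pqr t∉K =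
      let pq-pr , pq-qr , pr-qr = pairwise₃ (star-exclusive (t≢ (here refl)) cpq cpr cqr)
          cq-cr , cq-qr , cr-qr = pairwise₃ (star-exclusive (t≢ (there (here refl)))
                                    (edge-swap₁₂ cpq) (edge-swap₁₂ cpr) pqr)
          cp-cr , cp-pr , cr-pr = pairwise₃ (star-exclusive (t≢ (there (there (here refl))))
                                    (edge-rotate (edge-rotate cpq)) (edge-swap₁₂ cqr) (edge-swap₁₂ pqr))
          cp-cq , cp-pq , cq-pq = pairwise₃ (star-exclusive (t≢ (there (there (there (here refl)))))
                                    (edge-rotate (edge-rotate cpr)) (edge-rotate (edge-rotate cqr))
                                    (edge-rotate (edge-rotate pqr)))
      in (cp-cq ∷ cp-cr ∷ cp-pq ∷ cp-pr ∷ opposite-exclusive (edge⇒y≢z cpr) cpq cqr ∷ []) ∷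
         (cq-cr ∷ cq-pq ∷ opposite-exclusive (edge⇒y≢z cqr) (edge-swap₂₃ cpq) cpr ∷ cq-qr ∷ []) ∷
         (opposite-exclusive (≢-sym (edge⇒y≢z cqr)) (edge-swap₂₃ cpr) cpq ∷ cr-pr ∷ cr-qr ∷ []) ∷
         (pq-pr ∷ pq-qr ∷ []) ∷ (pr-qr ∷ []) ∷ [] ∷ []
      where
      t≢ : ∀ {v} → v ∈ (c ∷ p ∷ q ∷ r ∷ []) → t ≢ v
      t≢ v∈K refl = t∉K v∈K

      pairwise₃ : ∀ {u v w} → AllPairs (Exclusive t) (u ∷ v ∷ w ∷ []) →
        Exclusive t u v × Exclusive t u w × Exclusive t v w
      pairwise₃ ((uv ∷ uw ∷ []) ∷ (vw ∷ []) ∷ [] ∷ []) = uv , uw , vw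

    module _ (m : ℕ) (m≤codeg : ∀ x y → x ≢ y → 0 < codeg H x y → m ≤ codeg H x y) where

      m≤codeg-edge : Edge x y z → m ≤ codeg H x y
      m≤codeg-edge xyz = m≤codeg _ _ (edge⇒x≢y xyz) (edge⇒0<codeg xyz)

      double-count : ∀ ps (K : List (Fin n)) → All (λ (x , y) → m ≤ codeg H x y) ps → Unique K →
        (∀ t → t ∉ K → linkCount ps t ≤ 1) → length ps * m + length K ≤ n + List.sum (map (linkCount ps) K)
      double-count ps K m≤ps K-unique ≤1 = ≤-trans
        (+-monoˡ-≤ (length K) (subst (length ps * m ≤_) (sym (∑-linkCount ps)) (sum-map-≥ _ m≤ps)))
        (∑-≤-length-except K K-unique ≤1)

      spread-edge-bound : Edge x y z → (∀ t → linkCount (pairsOf x y z) t ≤ 1) → 3 * m ≤ n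
      spread-edge-bound xyz ≤1 = subst₂ _≤_ (+-identityʳ _) (+-identityʳ n)
        (double-count _ [] (m≤codeg-edge xyz ∷ m≤codeg-edge (edge-swap₂₃ xyz) ∷ m≤codeg-edge (edge-rotate xyz) ∷ [])
          [] (λ t _ → ≤1 t))

      K4⁻-bound : Edge c p q → Edge c p r → Edge c q r → edge H p q r ≡ false → 3 * m + 4 ≤ n + 3
      K4⁻-bound {c} {p} {q} {r} cpq cpr cqr pqr = ≤-trans
        (double-count _ _
          (m≤codeg-edge (edge-rotate cpq) ∷ m≤codeg-edge (edge-rotate cpr) ∷ m≤codeg-edge (edge-rotate cqr) ∷ [])
          (star-vertices-unique cpq cpr cqr)
          (λ t t∉K → linkCount≤1 (star-exclusive (λ t≡c → t∉K (here t≡c)) cpq cpr cqr)))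
        (+-monoʳ-≤ n (K4⁻-vertex-links pqr))

      K4-bound : Edge c p q → Edge c p r → Edge c q r → Edge p q r → 6 * m + 4 ≤ n + 12
      K4-bound cpq cpr cqr pqr = ≤-trans
        (double-count _ _
          (m≤codeg-edge cpq ∷ m≤codeg-edge cqr ∷ m≤codeg-edge (edge-swap₂₃ cpr) ∷
           m≤codeg-edge pqr ∷ m≤codeg-edge (edge-swap₂₃ pqr) ∷ m≤codeg-edge (edge-rotate pqr) ∷ [])
          (star-vertices-unique cpq cpr cqr)
          (λ t t∉K → linkCount≤1 (K4-exclusive cpq cpr cqr pqr t∉K)))
        (+-monoʳ-≤ n K4-vertex-links)

      K4⁻⇒m≤n/3 : 6 ≤ n → Edge c p q → Edge c p r → Edge c q r → m ≤ n / 3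
      K4⁻⇒m≤n/3 {c} {p} {q} {r} 6≤n cpq cpr cqr with edge H p q r in pqr
      ... | true  = 6*m+4≤n+12⇒m≤n/3 6≤n (K4-bound cpq cpr cqr pqr)
      ... | false = 3*m+4≤n+3⇒m≤n/3 (K4⁻-bound cpq cpr cqr pqr)

      upper-bound : 6 ≤ n → NonEmpty H → m ≤ n / 3
      upper-bound 6≤n (x , y , z , xyz) with all? (λ t → linkCount (pairsOf x y z) t ≤? 1)
      ... | yes spread = 3*m≤n⇒m≤n/3 (spread-edge-bound xyz spread)
      ... | no ¬spread with ¬∀⟶∃¬ n _ (λ t → linkCount (pairsOf x y z) t ≤? 1) ¬spread
      ... | t , ¬≤1 with two-of-three (edge H x y t) (edge H x z t) (edge H y z t) ¬≤1
      ... | inj₁ (xyt , xzt)        = K4⁻⇒m≤n/3 6≤n xyz xyt xzt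
      ... | inj₂ (inj₁ (xyt , yzt)) = K4⁻⇒m≤n/3 6≤n (edge-swap₁₂ xyz) (edge-swap₁₂ xyt) yzt
      ... | inj₂ (inj₂ (xzt , yzt)) = K4⁻⇒m≤n/3 6≤n (edge-rotate (edge-rotate xyz))
                                        (edge-swap₁₂ xzt) (edge-swap₁₂ yzt)

isRainbow : Fin 3 → Fin 3 → Fin 3 → Bool
isRainbow a b c = not (does (a ≟ b)) ∧ not (does (b ≟ c)) ∧ not (does (a ≟ c))

rainbow-swap₁₂ : ∀ a b c → isRainbow a b c ≡ isRainbow b a c
rainbow-swap₁₂ = toWitness {a? = all? λ a → all? λ b → all? λ c → isRainbow a b c Bool.≟ isRainbow b a c} tt

rainbow-swap₂₃ : ∀ a b c → isRainbow a b c ≡ isRainbow a c b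
rainbow-swap₂₃ = toWitness {a? = all? λ a → all? λ b → all? λ c → isRainbow a b c Bool.≟ isRainbow a c b} tt

rainbow-distinct : ∀ a b c → isRainbow a b c ≡ true → (a ≢ b) × (b ≢ c) × (a ≢ c)
rainbow-distinct = toWitness {a? = all? λ a → all? λ b → all? λ c →
  (isRainbow a b c Bool.≟ true) →-dec (¬? (a ≟ b) ×-dec ¬? (b ≟ c) ×-dec ¬? (a ≟ c))} tt

rainbow-C5⁻-free : ∀ a b c d e → isRainbow a b c ≡ true → isRainbow b c d ≡ true → isRainbow d e a ≡ true → ⊥
rainbow-C5⁻-free = toWitness {a? = all? λ a → all? λ b → all? λ c → all? λ d → all? λ e →
  (isRainbow a b c Bool.≟ true) →-dec ((isRainbow b c d Bool.≟ true) →-dec ¬? (isRainbow d e a Bool.≟ true))} tt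

rainbow-link : ∀ a b → (∀ c → isRainbow a b c ≡ false) ⊎ ∃[ r ] ∀ c → isRainbow a b c ≡ does (r ≟ c)
rainbow-link = toWitness {a? = all? λ a → all? λ b →
  all? (λ c → isRainbow a b c Bool.≟ false) ⊎-dec any? (λ r → all? λ c → isRainbow a b c Bool.≟ does (r ≟ c))} tt

residue₃ : ℕ → Fin 3
residue₃ 0 = zero
residue₃ 1 = suc zero
residue₃ 2 = suc (suc zero)
residue₃ (suc (suc (suc k))) = residue₃ k

colour : ∀ {n} → Fin n → Fin 3
colour x = residue₃ (toℕ x)

rainbowGraph : ∀ n → ThreeGraph n
rainbowGraph n = record
  { edge     = λ x y z → isRainbow (colour x) (colour y) (colour z)
  ; sym₁₂    = λ x y z → rainbow-swap₁₂ (colour x) (colour y) (colour z)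
  ; sym₂₃    = λ x y z → rainbow-swap₂₃ (colour x) (colour y) (colour z)
  ; distinct = λ x y z xyz →
      let x≢y , y≢z , x≢z = rainbow-distinct (colour x) (colour y) (colour z) xyz
      in (x≢y ∘ cong colour) , (y≢z ∘ cong colour) , (x≢z ∘ cong colour)
  }

rainbowGraph-C5⁻-free : ∀ n → ¬ ContainsC5minus (rainbowGraph n)
rainbowGraph-C5⁻-free n (a , b , c , d , e , _ , abc , bcd , _ , dea) =
  rainbow-C5⁻-free (colour a) (colour b) (colour c) (colour d) (colour e) abc bcd dea

colourClassSize : Fin 3 → ℕ → ℕ
colourClassSize r n = ∑[ z < n ] 𝟙 (does (r ≟ colour z))

colourClassSize-+3 : ∀ r k → colourClassSize r (3 + k) ≡ suc (colourClassSize r k)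
colourClassSize-+3 zero             k = refl
colourClassSize-+3 (suc zero)       k = refl
colourClassSize-+3 (suc (suc zero)) k = refl

[3+k]/3≡1+k/3 : ∀ k → (3 + k) / 3 ≡ suc (k / 3)
[3+k]/3≡1+k/3 k = m/n≡1+[m∸n]/n {3 + k} {3} (s≤s (s≤s (s≤s z≤n)))

n/3≤colourClassSize : ∀ r n → n / 3 ≤ colourClassSize r n
n/3≤colourClassSize r 0 = z≤n
n/3≤colourClassSize r 1 = z≤n
n/3≤colourClassSize r 2 = z≤n
n/3≤colourClassSize r (suc (suc (suc k))) =
  subst₂ _≤_ (sym ([3+k]/3≡1+k/3 k)) (sym (colourClassSize-+3 r k)) (s≤s (n/3≤colourClassSize r k))

colourClassSize-last : ∀ n → colourClassSize (suc (suc zero)) n ≡ n / 3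
colourClassSize-last 0 = refl
colourClassSize-last 1 = refl
colourClassSize-last 2 = refl
colourClassSize-last (suc (suc (suc k))) =
  trans (colourClassSize-+3 (suc (suc zero)) k) (trans (cong suc (colourClassSize-last k)) (sym ([3+k]/3≡1+k/3 k)))

module _ (n : ℕ) where

  private
    G = rainbowGraph n

  codeg-rainbow-colourClass : ∀ x y r → (∀ c → isRainbow (colour x) (colour y) c ≡ does (r ≟ c)) →
    codeg G x y ≡ colourClassSize r n
  codeg-rainbow-colourClass x y r link≡ =
    trans (codeg≡∑link G x y) (sum-cong-≗ {n} (λ z → cong 𝟙 (link≡ (colour z))))

  n/3≤codeg-rainbow : ∀ x y → 0 < codeg G x y → n / 3 ≤ codeg G x y
  n/3≤codeg-rainbow x y 0<codeg with rainbow-link (colour x) (colour y)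
  ... | inj₁ empty = ⊥-elim (<-irrefl refl (subst (0 <_) codeg≡0 0<codeg))
    where
    codeg≡0 : codeg G x y ≡ 0
    codeg≡0 = trans (codeg≡∑link G x y) (trans (sum-cong-≗ {n} (λ z → cong 𝟙 (empty (colour z)))) (∑-const-0 {n}))
  ... | inj₂ (r , link≡) = subst (n / 3 ≤_) (sym (codeg-rainbow-colourClass x y r link≡)) (n/3≤colourClassSize r n)

rainbow-achievable : ∀ n → 3 ≤ n → Achievable n (n / 3)
rainbow-achievable 0 ()
rainbow-achievable 1 (s≤s ())
rainbow-achievable 2 (s≤s (s≤s ()))
rainbow-achievable n@(suc (suc (suc k))) _ =
  rainbowGraph n , (zero , suc zero , suc (suc zero) , refl) , rainbowGraph-C5⁻-free n ,
  ((zero , suc zero , (λ ()) , subst (0 <_) (sym codeg₀₁) 0<n/3 , codeg₀₁) , λ x y _ → n/3≤codeg-rainbow n x y)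
  where
  codeg₀₁ : codeg (rainbowGraph n) zero (suc zero) ≡ n / 3
  codeg₀₁ = trans (codeg-rainbow-colourClass n zero (suc zero) (suc (suc zero))
                    λ { zero → refl ; (suc zero) → refl ; (suc (suc zero)) → refl })
                  (colourClassSize-last n)
  0<n/3 : 0 < n / 3
  0<n/3 = subst (0 <_) (sym ([3+k]/3≡1+k/3 k)) (s≤s z≤n)

theorem1 : (n : ℕ) → 6 ≤ n → CoPlusExC5minus≡ n (n / 3)
theorem1 n 6≤n =
  rainbow-achievable n (≤-trans (s≤s (s≤s (s≤s z≤n))) 6≤n) ,
  λ { m (H , nonempty , free , _ , m≤codeg) → upper-bound H free m m≤codeg 6≤n nonempty }
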